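{- Let $G$ be a connected graph with at least one looped vertex. Then $\varepsilon(G)>1$, where $\varepsilon(G)=q_N(G)(0)$.
   Context: Graphs are finite and may have loops (at most one per vertex) but no multiple edges. The adjacency matrix over $GF(2)$ has diagonal entry $1$ exactly at looped vertices; $n(\cdot)$ denotes nullity over $GF(2)$ (empty graph: $n=0$), and $G[S]$ is the induced subgraph. The (unweighted) vertex-nullity interlace polynomial is $q_N(G)=\sum_{S\subseteq V(G)}(y-1)^{n(G[S])}\in\mathbb{Z}[y]$, and $\varepsilon(G)$ is its value at $y=0$. -}

module Defs where

open import Data.Bool using (Bool; true; false; _∧_; _xor_; if_then_else_; not)
open import Data.Nat using (ℕ; zero; suc)
open import Data.Nat.Logarithm using (⌊log₂_⌋)
open import Data.Fin using (Fin) renaming (zero to fzero; suc to fsuc)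
open import Data.Vec using (Vec; []; _∷_; lookup)
open import Data.List using (List; []; _∷_; map; _++_; length; filter; foldr; allFin)
open import Data.Integer using (ℤ; +_; -_; _+_)
open import Relation.Binary.PropositionalEquality using (_≡_)
open import Relation.Nullary using (Dec; yes; no)
open import Data.Bool.Properties using () renaming (_≟_ to _≟ᵇ_)
open import Data.List.Relation.Unary.All using (All)
open import Data.Product using (∃)

-- A finite graph on vertex set Fin n, given by its adjacency matrix over GF(2)
-- (Bool with xor as addition and ∧ as multiplication).  The diagonal entry
-- adj v v is true exactly when v carries a loop.
record Graph (n : ℕ) : Set where
  field
    adj   : Fin n → Fin n → Bool
    symm  : ∀ u v → adj u v ≡ adj v u
open Graph public

data Reach {n : ℕ} (G : Graph n) : Fin n → Fin n → Set where
  here : ∀ {u} → Reach G u u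
  step : ∀ {u v w} → adj G u v ≡ true → Reach G v w → Reach G u w

Connected : ∀ {n} → Graph n → Set
Connected {n} G = ∀ (u v : Fin n) → Reach G u v

HasLoop : ∀ {n} → Graph n → Set
HasLoop {n} G = ∃ λ (v : Fin n) → adj G v v ≡ true

allVecs : (n : ℕ) → List (Vec Bool n)
allVecs zero = [] ∷ []
allVecs (suc n) = map (false ∷_) (allVecs n) ++ map (true ∷_) (allVecs n)

xorSum : ∀ {n} → (Fin n → Bool) → Bool
xorSum {zero} f = false
xorSum {suc n} f = f fzero xor xorSum {n} (λ i → f (fsuc i))

_⊆ᵇ_ : ∀ {n} → Vec Bool n → Vec Bool n → Bool
[] ⊆ᵇ [] = true
(false ∷ x) ⊆ᵇ (_ ∷ S) = x ⊆ᵇ S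
(true ∷ x) ⊆ᵇ (b ∷ S) = b ∧ (x ⊆ᵇ S)

inKernelᵇ : ∀ {n} → Graph n → Vec Bool n → Vec Bool n → Bool
inKernelᵇ {n} G S x =
  (x ⊆ᵇ S) ∧ allᵇ (λ i → if lookup S i
                           then not (xorSum (λ j → adj G i j ∧ lookup x j))
                           else true)
  where
    allᵇ : (Fin n → Bool) → Bool
    allᵇ f = foldr _∧_ true (map (λ v → f v) (allFin n))

kernelOf : ∀ {n} → Graph n → Vec Bool n → List (Vec Bool n)
kernelOf {n} G S = filter (λ x → inKernelᵇ G S x ≟ᵇ true) (allVecs n)

-- Nullity of G[S] over GF(2): the kernel is a GF(2)-subspace, so it has
-- exactly 2^k elements where k = dim ker; hence k = ⌊log₂ |ker|⌋.
-- (Empty S gives kernel {0}, nullity 0.)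
nullity : ∀ {n} → Graph n → Vec Bool n → ℕ
nullity G S = ⌊log₂ length (kernelOf G S) ⌋

negOnePow : ℕ → ℤ
negOnePow zero = + 1
negOnePow (suc k) = - negOnePow k

-- ε(G) = q_N(G)(0) = Σ_{S ⊆ V} (0 - 1)^{n(G[S])}
ε : ∀ {n} → Graph n → ℤ
ε {n} G = foldr _+_ (+ 0) (map (λ S → negOnePow (nullity G S)) (allVecs n))

-- For W ⊆ V write ε_W(G) = Σ_{S ⊆ W} (-1)^{n(G[S])}, which is ε(G[W]). If a ∈ W is looped,
-- then n(G[S ∪ {a}]) = n((G * a)[S]) for S ⊆ W - a, where G * a is the local complement at a;
-- pairing S with S ∪ {a} gives ε_W(G) = ε_{W-a}(G) + ε_{W-a}(G * a). If G[W] is loopless,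
-- then n(G[S]) ≡ |S| (mod 2) for all S ⊆ W (an isolated vertex adds one to the nullity, and
-- pivoting on an edge removes two vertices without changing it), so ε_W(G) = 0 for W ≠ ∅.
-- By induction ε_W ≥ 0 always. If moreover every vertex of W reaches a loop inside G[W],
-- then the same holds for G[W - a] or for (G * a)[W - a] (a neighbour of a that reaches no
-- loop in G[W - a] becomes looped in G * a), and induction gives ε_W ≥ 2; take W = V.

module Submission where

open import Defs
open import Data.Nat using (ℕ)
open import Data.Integer using (+_; _<_)

open import Algebra.Bundles using (CommutativeSemigroup; CommutativeRing)
open import Algebra.Core using (Op₂)
import Algebra.Properties.CommutativeSemigroup as CommutativeSemigroupProperties
open import Algebra.Structures using (IsCommutativeMonoid)
open import Data.Bool using (Bool; true; false; _∧_; _xor_; not; if_then_else_)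
import Data.Bool as Bool
open import Data.Bool.Properties using (∧-zeroʳ; ∧-identityʳ; ∧-assoc; ∧-comm; ∧-distribʳ-xor)
open import Data.Bool.Properties using (xor-assoc; xor-comm; xor-identityʳ; xor-same; xor-∧-commutativeRing)
open import Data.Bool.Properties using (¬-not; not-¬; ⇔→≡; T-≡; T-not-≡; T-∧) renaming (_≟_ to _≟ᵇ_)
open import Data.Empty using (⊥; ⊥-elim)
open import Data.Fin using (Fin; zero; suc; _≟_)
open import Data.Fin.Properties using (any?)
import Data.Integer as ℤ
import Data.Integer.Properties as ZP
open import Data.List using (List; allFin)
import Data.List as List
import Data.List.Properties as ListProperties
open import Data.List.Relation.Unary.All.Properties using (all⁺; all⁻; tabulate⁺; tabulate⁻)
import Data.Nat as ℕ
open import Data.Nat.Logarithm using (⌊log₂_⌋; ⌊log₂[2*b]⌋≡1+⌊log₂b⌋)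
import Data.Nat.Properties as NP
open import Data.Product using (∃; _×_; _,_; proj₁; proj₂)
open import Data.Sum using (_⊎_; inj₁; inj₂)
open import Data.Vec using (Vec; []; _∷_; lookup; replicate; _[_]≔_)
open import Data.Vec.Properties
  using (lookup∘update; lookup∘update′; []≔-idempotent; []≔-lookup; lookup-replicate)
open import Function using (_∘_; id; case_of_; _⇔_; mk⇔; Equivalence)
open import Function.Properties.Equivalence using () renaming (sym to sym⇔; trans to trans⇔)
open import Level using (0ℓ)
open import Relation.Binary.PropositionalEquality
open import Relation.Nullary using (¬_; Dec; yes; no; contradiction; _×-dec_)
open import Relation.Nullary using (¬¬-excluded-middle; decidable-stable)
open import Relation.Nullary.Negation using (¬¬-map)

private
  variable
    n : ℕ

-- Subsets of Fin n as Boolean vectors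

_∈_ : Fin n → Vec Bool n → Set
i ∈ S = lookup S i ≡ true

_∉_ : Fin n → Vec Bool n → Set
i ∉ S = lookup S i ≡ false

_⊆_ : Vec Bool n → Vec Bool n → Set
S ⊆ T = ∀ {i} → i ∈ S → i ∈ T

insert : Fin n → Vec Bool n → Vec Bool n
insert a S = S [ a ]≔ true

remove : Fin n → Vec Bool n → Vec Bool n
remove a S = S [ a ]≔ false

∈∉⇒⊥ : ∀ {i} (S : Vec Bool n) → i ∈ S → i ∉ S → ⊥
∈∉⇒⊥ S i∈S i∉S with () ← trans (sym i∉S) i∈S

∈⇒≢ : ∀ {a i} (S : Vec Bool n) → a ∉ S → i ∈ S → i ≢ a
∈⇒≢ S a∉S i∈S refl = ∈∉⇒⊥ S i∈S a∉S

∅ : Vec Bool n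
∅ {n} = replicate n false

full : Vec Bool n
full {n} = replicate n true

∈full : ∀ (i : Fin n) → i ∈ full
∈full i = lookup-replicate i true

∉∅ : ∀ (i : Fin n) → i ∉ ∅
∉∅ i = lookup-replicate i false

∅⊆ : (S : Vec Bool n) → ∅ ⊆ S
∅⊆ S {i} i∈∅ = ⊥-elim (∈∉⇒⊥ {i = i} ∅ i∈∅ (∉∅ i))

a∈insert : ∀ a (S : Vec Bool n) → a ∈ insert a S
a∈insert a S = lookup∘update a S true

a∉remove : ∀ a (S : Vec Bool n) → a ∉ remove a S
a∉remove a S = lookup∘update a S false

⊆-insert : ∀ a (S : Vec Bool n) → S ⊆ insert a S
⊆-insert a S {i} i∈S with i ≟ a
... | yes refl = a∈insert a S
... | no i≢a = trans (lookup∘update′ i≢a S true) i∈S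

∈-insert⁻ : ∀ {a i} (S : Vec Bool n) → i ∈ insert a S → i ≡ a ⊎ i ∈ S
∈-insert⁻ {a = a} {i} S i∈ with i ≟ a
... | yes i≡a = inj₁ i≡a
... | no i≢a = inj₂ (trans (sym (lookup∘update′ i≢a S true)) i∈)

∈-remove⁻ : ∀ {a i} (S : Vec Bool n) → i ∈ remove a S → i ∈ S
∈-remove⁻ {a = a} {i} S i∈ with i ≟ a
... | yes refl = ⊥-elim (∈∉⇒⊥ (remove a S) i∈ (a∉remove a S))
... | no i≢a = trans (sym (lookup∘update′ i≢a S false)) i∈

∈-remove⁺ : ∀ {a i} (S : Vec Bool n) → i ≢ a → i ∈ S → i ∈ remove a S
∈-remove⁺ S i≢a i∈S = trans (lookup∘update′ i≢a S false) i∈S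

insert-remove : ∀ {a} (S : Vec Bool n) → a ∈ S → insert a (remove a S) ≡ S
insert-remove {a = a} S a∈S = begin
  (S [ a ]≔ false) [ a ]≔ true ≡⟨ []≔-idempotent S a ⟩
  S [ a ]≔ true                ≡⟨ cong (S [ a ]≔_) a∈S ⟨
  S [ a ]≔ lookup S a          ≡⟨ []≔-lookup S a ⟩
  S                            ∎
  where open ≡-Reasoning

∉-remove : ∀ {a} b (T : Vec Bool n) → a ∉ T → a ∉ remove b T
∉-remove b T a∉T = ¬-not (λ a∈ → ∈∉⇒⊥ T (∈-remove⁻ T a∈) a∉T)

⊆-remove⁺ : ∀ {a} (S W : Vec Bool n) → a ∉ S → S ⊆ W → S ⊆ remove a W
⊆-remove⁺ S W a∉S S⊆W i∈S = ∈-remove⁺ W (∈⇒≢ S a∉S i∈S) (S⊆W i∈S)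

⊆-remove⁻ : ∀ {a} (S W : Vec Bool n) → S ⊆ remove a W → S ⊆ W
⊆-remove⁻ S W S⊆ i∈S = ∈-remove⁻ W (S⊆ i∈S)

insert-⊆ : ∀ {a} (S W : Vec Bool n) → a ∈ W → S ⊆ W → insert a S ⊆ W
insert-⊆ S W a∈W S⊆W i∈ with ∈-insert⁻ S i∈
... | inj₁ refl = a∈W
... | inj₂ i∈S = S⊆W i∈S

insertIf : Bool → Fin n → Vec Bool n → Vec Bool n
insertIf false a x = x
insertIf true a x = insert a x

insertIf-mono : ∀ s a (x S : Vec Bool n) → x ⊆ S → insertIf s a x ⊆ insert a S
insertIf-mono false a x S x⊆S = ⊆-insert a S ∘ x⊆S
insertIf-mono true a x S x⊆S = insert-⊆ x (insert a S) (a∈insert a S) (⊆-insert a S ∘ x⊆S)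

⊆-insertIf : ∀ s a (x : Vec Bool n) → x ⊆ insertIf s a x
⊆-insertIf false a x = id
⊆-insertIf true a x = ⊆-insert a x

insertIf-mono⁻ : ∀ s a (x S : Vec Bool n) → a ∉ x → insertIf s a x ⊆ insert a S → x ⊆ S
insertIf-mono⁻ s a x S a∉x ⊆S+a i∈x with ∈-insert⁻ S (⊆S+a (⊆-insertIf s a x i∈x))
... | inj₁ refl = ⊥-elim (∈∉⇒⊥ x i∈x a∉x)
... | inj₂ i∈S = i∈S

∉-insertIf : ∀ t {a b} (x : Vec Bool n) → a ≢ b → a ∉ x → a ∉ insertIf t b x
∉-insertIf false x _ a∉x = a∉x
∉-insertIf true x a≢b a∉x = trans (lookup∘update′ a≢b x true) a∉x

size : Vec Bool n → ℕ
size [] = 0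
size (b ∷ S) = if b then ℕ.suc (size S) else size S

size-insert : ∀ a (S : Vec Bool n) → a ∉ S → size (insert a S) ≡ ℕ.suc (size S)
size-insert zero (false ∷ S) _ = refl
size-insert (suc a) (false ∷ S) a∉S = size-insert a S a∉S
size-insert (suc a) (true ∷ S) a∉S = cong ℕ.suc (size-insert a S a∉S)

size-remove : ∀ a (S : Vec Bool n) → a ∈ S → size S ≡ ℕ.suc (size (remove a S))
size-remove a S a∈S = begin
  size S                       ≡⟨ cong size (insert-remove S a∈S) ⟨
  size (insert a (remove a S)) ≡⟨ size-insert a (remove a S) (a∉remove a S) ⟩
  ℕ.suc (size (remove a S))    ∎
  where open ≡-Reasoning

remove-shrinks : ∀ {k a} (S : Vec Bool n) → a ∈ S → size S ℕ.< ℕ.suc k → size (remove a S) ℕ.< k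
remove-shrinks {a = a} S a∈S size< = NP.≤-pred (subst (ℕ._< _) (size-remove a S a∈S) size<)

size≤length : (S : Vec Bool n) → size S ℕ.≤ n
size≤length [] = ℕ.z≤n
size≤length (false ∷ S) = NP.m≤n⇒m≤1+n (size≤length S)
size≤length (true ∷ S) = ℕ.s≤s (size≤length S)

Empty : Vec Bool n → Set
Empty {n} S = ∀ (i : Fin n) → i ∉ S

size-empty : (S : Vec Bool n) → Empty S → size S ≡ 0
size-empty [] _ = refl
size-empty (b ∷ S) S-empty rewrite S-empty zero = size-empty S (S-empty ∘ suc)

nonempty-or-empty : (S : Vec Bool n) → (∃ λ i → i ∈ S) ⊎ Empty S
nonempty-or-empty S with any? (λ i → lookup S i ≟ᵇ true)
... | yes i∈S = inj₁ i∈S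
... | no ∄i∈S = inj₂ (λ i → ¬-not (λ i∈S → ∄i∈S (i , i∈S)))

⊆ᵇ⇔⊆ : (x S : Vec Bool n) → x ⊆ᵇ S ≡ true ⇔ x ⊆ S
⊆ᵇ⇔⊆ x S = mk⇔ (to x S) (from x S)
  where
  to : ∀ {n} (x S : Vec Bool n) → x ⊆ᵇ S ≡ true → x ⊆ S
  to (false ∷ x) (_ ∷ S) x⊆S {suc i} i∈x = to x S x⊆S i∈x
  to (true ∷ x) (true ∷ S) x⊆S {zero} _ = refl
  to (true ∷ x) (true ∷ S) x⊆S {suc i} i∈x = to x S x⊆S i∈x
  from : ∀ {n} (x S : Vec Bool n) → x ⊆ S → x ⊆ᵇ S ≡ true
  from [] [] _ = refl
  from (false ∷ x) (_ ∷ S) x⊆S = from x S (x⊆S {suc _})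
  from (true ∷ x) (b ∷ S) x⊆S rewrite x⊆S {zero} refl = from x S (x⊆S {suc _})

⊆ᵇ-cong : (x S y T : Vec Bool n) → x ⊆ S ⇔ y ⊆ T → x ⊆ᵇ S ≡ y ⊆ᵇ T
⊆ᵇ-cong x S y T x⊆S⇔y⊆T = ⇔→≡ (trans⇔ (⊆ᵇ⇔⊆ x S) (trans⇔ x⊆S⇔y⊆T (sym⇔ (⊆ᵇ⇔⊆ y T))))

⊆ᵇ-false : (S W : Vec Bool n) → ¬ S ⊆ W → S ⊆ᵇ W ≡ false
⊆ᵇ-false S W S⊈W = ¬-not (S⊈W ∘ Equivalence.to (⊆ᵇ⇔⊆ S W))

⊆ᵇ-remove : ∀ {a} (S W : Vec Bool n) → a ∉ S → S ⊆ᵇ W ≡ S ⊆ᵇ remove a W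
⊆ᵇ-remove S W a∉S = ⊆ᵇ-cong S W S (remove _ W) (mk⇔ (⊆-remove⁺ S W a∉S) (⊆-remove⁻ S W))

insert-⊆ᵇ-remove : ∀ {a} (S W : Vec Bool n) → a ∈ W → a ∉ S → insert a S ⊆ᵇ W ≡ S ⊆ᵇ remove a W
insert-⊆ᵇ-remove {a = a} S W a∈W a∉S = ⊆ᵇ-cong (insert a S) W S (remove a W) (mk⇔ to from)
  where
  to : insert a S ⊆ W → S ⊆ remove a W
  to S+a⊆W = ⊆-remove⁺ S W a∉S (λ i∈S → S+a⊆W (⊆-insert a S i∈S))
  from : S ⊆ remove a W → insert a S ⊆ W
  from S⊆W-a = insert-⊆ S W a∈W (⊆-remove⁻ S W S⊆W-a)

-- Sums over all Boolean vectors

module BoolVecSum {A : Set} {_∙_ : Op₂ A} {0# : A} (isCM : IsCommutativeMonoid _≡_ _∙_ 0#) where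

  open IsCommutativeMonoid isCM using (assoc; identityˡ; identityʳ; isCommutativeSemigroup)

  commutativeSemigroup : CommutativeSemigroup 0ℓ 0ℓ
  commutativeSemigroup = record { isCommutativeSemigroup = isCommutativeSemigroup }

  open CommutativeSemigroupProperties commutativeSemigroup using (interchange)

  ∑ : (Vec Bool n → A) → A
  ∑ {ℕ.zero} f = f []
  ∑ {ℕ.suc n} f = ∑ (f ∘ (false ∷_)) ∙ ∑ (f ∘ (true ∷_))

  ∑-cong : {f g : Vec Bool n → A} → (∀ x → f x ≡ g x) → ∑ f ≡ ∑ g
  ∑-cong {ℕ.zero} f≗g = f≗g []
  ∑-cong {ℕ.suc n} f≗g = cong₂ _∙_ (∑-cong (f≗g ∘ (false ∷_))) (∑-cong (f≗g ∘ (true ∷_)))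

  ∑-distrib : (f g : Vec Bool n → A) → ∑ (λ x → f x ∙ g x) ≡ ∑ f ∙ ∑ g
  ∑-distrib {ℕ.zero} f g = refl
  ∑-distrib {ℕ.suc n} f g = trans
    (cong₂ _∙_ (∑-distrib (f ∘ (false ∷_)) (g ∘ (false ∷_)))
               (∑-distrib (f ∘ (true ∷_)) (g ∘ (true ∷_))))
    (interchange _ _ _ _)

  ∑-0# : ∀ n → ∑ {n} (λ _ → 0#) ≡ 0#
  ∑-0# ℕ.zero = refl
  ∑-0# (ℕ.suc n) = trans (cong₂ _∙_ (∑-0# n) (∑-0# n)) (identityˡ 0#)

  ∑-supported-at-∅ : (f : Vec Bool n → A) → (∀ x {i} → i ∈ x → f x ≡ 0#) → ∑ f ≡ f ∅
  ∑-supported-at-∅ {ℕ.zero} f _ = refl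
  ∑-supported-at-∅ {ℕ.suc n} f f-vanishes = begin
    ∑ (f ∘ (false ∷_)) ∙ ∑ (f ∘ (true ∷_)) ≡⟨ cong₂ _∙_ at-∅ (∑-cong λ x → f-vanishes (true ∷ x) {zero} refl) ⟩
    f ∅ ∙ ∑ {n} (λ _ → 0#)                 ≡⟨ cong (f ∅ ∙_) (∑-0# n) ⟩
    f ∅ ∙ 0#                               ≡⟨ identityʳ (f ∅) ⟩
    f ∅                                    ∎
    where
    open ≡-Reasoning
    at-∅ : ∑ (f ∘ (false ∷_)) ≡ f ∅
    at-∅ = ∑-supported-at-∅ (f ∘ (false ∷_)) (λ x {i} i∈x → f-vanishes (false ∷ x) {suc i} i∈x)

  ∑-pair : ∀ a (f : Vec Bool n → A) →
           ∑ f ≡ ∑ (λ x → if lookup x a then 0# else f x ∙ f (insert a x))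
  ∑-pair {ℕ.suc n} zero f = begin
    ∑ (f ∘ (false ∷_)) ∙ ∑ (f ∘ (true ∷_)) ≡⟨ ∑-distrib (f ∘ (false ∷_)) (f ∘ (true ∷_)) ⟨
    ∑ paired                               ≡⟨ identityʳ (∑ paired) ⟨
    ∑ paired ∙ 0#                          ≡⟨ cong (∑ paired ∙_) (∑-0# n) ⟨
    ∑ paired ∙ ∑ {n} (λ _ → 0#)            ∎
    where
    open ≡-Reasoning
    paired : Vec Bool n → A
    paired x = f (false ∷ x) ∙ f (true ∷ x)
  ∑-pair {ℕ.suc n} (suc a) f = cong₂ _∙_ (∑-pair a (f ∘ (false ∷_))) (∑-pair a (f ∘ (true ∷_)))

  ∑-pairing : ∀ a (f g : Vec Bool n → A) →
              (∀ x → a ∈ x → g x ≡ 0#) →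
              (∀ x → a ∉ x → f x ∙ f (insert a x) ≡ g x) →
              ∑ f ≡ ∑ g
  ∑-pairing a f g g-vanishes pairs = trans (∑-pair a f) (∑-cong pointwise)
    where
    pointwise : ∀ x → (if lookup x a then 0# else f x ∙ f (insert a x)) ≡ g x
    pointwise x with lookup x a in x[a]
    ... | true = sym (g-vanishes x x[a])
    ... | false = pairs x x[a]

  ∑-allVecs : (f : Vec Bool n → A) → List.foldr _∙_ 0# (List.map f (allVecs n)) ≡ ∑ f
  ∑-allVecs {ℕ.zero} f = identityʳ (f [])
  ∑-allVecs {ℕ.suc n} f = begin
    sum (List.map f (List.map (false ∷_) vs List.++ List.map (true ∷_) vs))
      ≡⟨ cong sum (ListProperties.map-++ f (List.map (false ∷_) vs) _) ⟩
    sum (List.map f (List.map (false ∷_) vs) List.++ List.map f (List.map (true ∷_) vs))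
      ≡⟨ sum-++ (List.map f (List.map (false ∷_) vs)) _ ⟩
    sum (List.map f (List.map (false ∷_) vs)) ∙ sum (List.map f (List.map (true ∷_) vs))
      ≡⟨ cong₂ _∙_ (cong sum (ListProperties.map-∘ vs)) (cong sum (ListProperties.map-∘ vs)) ⟨
    sum (List.map (f ∘ (false ∷_)) vs) ∙ sum (List.map (f ∘ (true ∷_)) vs)
      ≡⟨ cong₂ _∙_ (∑-allVecs (f ∘ (false ∷_))) (∑-allVecs (f ∘ (true ∷_))) ⟩
    ∑ (f ∘ (false ∷_)) ∙ ∑ (f ∘ (true ∷_)) ∎
    where
    open ≡-Reasoning
    vs = allVecs n
    sum : List A → A
    sum = List.foldr _∙_ 0#
    sum-++ : ∀ xs ys → sum (xs List.++ ys) ≡ sum xs ∙ sum ys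
    sum-++ List.[] ys = sym (identityˡ _)
    sum-++ (x List.∷ xs) ys = trans (cong (x ∙_) (sum-++ xs ys)) (sym (assoc _ _ _))

-- Inner products over GF(2), local complementation and pivoting

module XorProperties = CommutativeSemigroupProperties
  (CommutativeRing.+-commutativeSemigroup xor-∧-commutativeRing)

xorSum-cong : {f g : Fin n → Bool} → (∀ j → f j ≡ g j) → xorSum f ≡ xorSum g
xorSum-cong {ℕ.zero} _ = refl
xorSum-cong {ℕ.suc n} f≗g = cong₂ _xor_ (f≗g zero) (xorSum-cong (f≗g ∘ suc))

xorSum-false : ∀ n → xorSum {n} (λ _ → false) ≡ false
xorSum-false ℕ.zero = refl
xorSum-false (ℕ.suc n) = xorSum-false n

xorSum-xor : (f g : Fin n → Bool) → xorSum (λ j → f j xor g j) ≡ xorSum f xor xorSum g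
xorSum-xor {ℕ.zero} f g = refl
xorSum-xor {ℕ.suc n} f g = trans
  (cong ((f zero xor g zero) xor_) (xorSum-xor (f ∘ suc) (g ∘ suc)))
  (XorProperties.interchange (f zero) (g zero) _ _)

xorSum-∧ : ∀ c (f : Fin n → Bool) → xorSum (λ j → c ∧ f j) ≡ c ∧ xorSum f
xorSum-∧ {n} false f = xorSum-false n
xorSum-∧ true f = refl

dot : (Fin n → Bool) → Vec Bool n → Bool
dot f x = xorSum (λ j → f j ∧ lookup x j)

dot-xor : (f g : Fin n → Bool) (x : Vec Bool n) → dot (λ j → f j xor g j) x ≡ dot f x xor dot g x
dot-xor f g x = trans (xorSum-cong (λ j → ∧-distribʳ-xor (lookup x j) (f j) (g j)))
                      (xorSum-xor (λ j → f j ∧ lookup x j) (λ j → g j ∧ lookup x j))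

dot-scale : ∀ c (f : Fin n → Bool) (x : Vec Bool n) → dot (λ j → c ∧ f j) x ≡ c ∧ dot f x
dot-scale c f x = trans (xorSum-cong (λ j → ∧-assoc c (f j) (lookup x j)))
                        (xorSum-∧ c (λ j → f j ∧ lookup x j))

dot-vanishes : (f : Fin n → Bool) (x : Vec Bool n) → (∀ {j} → j ∈ x → f j ≡ false) → dot f x ≡ false
dot-vanishes {n} f x f-vanishes = trans (xorSum-cong term-vanishes) (xorSum-false n)
  where
  term-vanishes : ∀ j → f j ∧ lookup x j ≡ false
  term-vanishes j with lookup x j in x[j]
  ... | false = ∧-zeroʳ (f j)
  ... | true = cong (_∧ true) (f-vanishes {j} x[j])

dot-insert : (f : Fin n → Bool) (x : Vec Bool n) → ∀ {a} → a ∉ x → dot f (insert a x) ≡ dot f x xor f a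
dot-insert f (false ∷ x) {zero} _ = begin
  (f zero ∧ true) xor r          ≡⟨ cong (_xor r) (∧-identityʳ (f zero)) ⟩
  f zero xor r                   ≡⟨ xor-comm (f zero) r ⟩
  r xor f zero                   ≡⟨ cong (λ c → (c xor r) xor f zero) (∧-zeroʳ (f zero)) ⟨
  ((f zero ∧ false) xor r) xor f zero ∎
  where
  open ≡-Reasoning
  r = dot (f ∘ suc) x
dot-insert f (b ∷ x) {suc a} a∉x = trans
  (cong ((f zero ∧ b) xor_) (dot-insert (f ∘ suc) x a∉x))
  (sym (xor-assoc (f zero ∧ b) _ _))

dot-insertIf : (f : Fin n → Bool) (x : Vec Bool n) → ∀ s {a} → a ∉ x →
               dot f (insertIf s a x) ≡ dot f x xor (s ∧ f a)
dot-insertIf f x false _ = sym (xor-identityʳ (dot f x))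
dot-insertIf f x true a∉x = dot-insert f x a∉x

xor≡false⇒≡ : ∀ {p q} → p xor q ≡ false → p ≡ q
xor≡false⇒≡ {false} p⊕q≡0 = sym p⊕q≡0
xor≡false⇒≡ {true} {true} _ = refl

≡⇒xor≡false : ∀ {p q} → p ≡ q → p xor q ≡ false
≡⇒xor≡false {p} refl = xor-same p

row : Graph n → Fin n → Vec Bool n → Bool
row G i = dot (adj G i)

localComplement : Graph n → Fin n → Graph n
localComplement G a = record
  { adj = λ i j → adj G i j xor (adj G i a ∧ adj G a j)
  ; symm = λ i j → cong₂ _xor_ (symm G i j)
      (trans (cong₂ _∧_ (symm G i a) (symm G a j)) (∧-comm (adj G a i) (adj G j a)))
  }

pivot : Graph n → Fin n → Fin n → Graph n
pivot G a b = record
  { adj = λ i j → (adj G i j xor (adj G i a ∧ adj G b j)) xor (adj G i b ∧ adj G a j)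
  ; symm = λ i j → trans
      (cong₂ _xor_ (cong₂ _xor_ (symm G i j) (flip-∧ i a b j)) (flip-∧ i b a j))
      (XorProperties.xy∙z≈xz∙y (adj G j i) _ _)
  }
  where
  flip-∧ : ∀ i a b j → adj G i a ∧ adj G b j ≡ adj G j b ∧ adj G a i
  flip-∧ i a b j = trans (cong₂ _∧_ (symm G i a) (symm G b j)) (∧-comm (adj G a i) (adj G j b))

row-localComplement : (G : Graph n) (a i : Fin n) (x : Vec Bool n) →
                      row (localComplement G a) i x ≡ row G i x xor (row G a x ∧ adj G i a)
row-localComplement G a i x = trans (dot-xor (adj G i) _ x) (cong (row G i x xor_)
  (trans (dot-scale (adj G i a) (adj G a) x) (∧-comm (adj G i a) (row G a x))))

row-pivot : (G : Graph n) (a b i : Fin n) (x : Vec Bool n) →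
            row (pivot G a b) i x ≡ (row G i x xor (row G a x ∧ adj G i b)) xor (row G b x ∧ adj G i a)
row-pivot G a b i x = begin
  row (pivot G a b) i x
    ≡⟨ dot-xor (λ j → adj G i j xor (adj G i a ∧ adj G b j)) _ x ⟩
  dot (λ j → adj G i j xor (adj G i a ∧ adj G b j)) x xor dot (λ j → adj G i b ∧ adj G a j) x
    ≡⟨ cong₂ _xor_ (dot-xor (adj G i) _ x) (dot-scale (adj G i b) (adj G a) x) ⟩
  (row G i x xor dot (λ j → adj G i a ∧ adj G b j) x) xor (adj G i b ∧ row G a x)
    ≡⟨ cong (λ c → (row G i x xor c) xor (adj G i b ∧ row G a x)) (dot-scale (adj G i a) (adj G b) x) ⟩
  (row G i x xor (adj G i a ∧ row G b x)) xor (adj G i b ∧ row G a x)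
    ≡⟨ XorProperties.xy∙z≈xz∙y (row G i x) _ _ ⟩
  (row G i x xor (adj G i b ∧ row G a x)) xor (adj G i a ∧ row G b x)
    ≡⟨ cong₂ (λ e f → (row G i x xor e) xor f) (∧-comm (adj G i b) _) (∧-comm (adj G i a) _) ⟩
  (row G i x xor (row G a x ∧ adj G i b)) xor (row G b x ∧ adj G i a) ∎
  where open ≡-Reasoning

pivot-loop : (G : Graph n) (a b i : Fin n) → adj (pivot G a b) i i ≡ adj G i i
pivot-loop G a b i = begin
  (adj G i i xor (adj G i a ∧ adj G b i)) xor (adj G i b ∧ adj G a i)
    ≡⟨ cong (λ c → (adj G i i xor (adj G i a ∧ adj G b i)) xor c) same-term ⟩
  (adj G i i xor (adj G i a ∧ adj G b i)) xor (adj G i a ∧ adj G b i)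
    ≡⟨ xor-assoc (adj G i i) _ _ ⟩
  adj G i i xor ((adj G i a ∧ adj G b i) xor (adj G i a ∧ adj G b i))
    ≡⟨ cong (adj G i i xor_) (xor-same (adj G i a ∧ adj G b i)) ⟩
  adj G i i xor false
    ≡⟨ xor-identityʳ (adj G i i) ⟩
  adj G i i ∎
  where
  open ≡-Reasoning
  same-term : adj G i b ∧ adj G a i ≡ adj G i a ∧ adj G b i
  same-term = trans (cong₂ _∧_ (symm G i b) (symm G a i)) (∧-comm (adj G b i) (adj G i a))

localComplement-away : (G : Graph n) (a i j : Fin n) → adj G i a ≡ false →
                       adj (localComplement G a) i j ≡ adj G i j
localComplement-away G a i j i≁a = trans (cong (λ e → adj G i j xor (e ∧ adj G a j)) i≁a) (xor-identityʳ _)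

localComplement-toggles : (G : Graph n) (a i j : Fin n) → adj G i a ≡ true → adj G a j ≡ true →
                          adj (localComplement G a) i j ≡ not (adj G i j)
localComplement-toggles G a i j i~a a~j =
  trans (cong₂ (λ e f → adj G i j xor (e ∧ f)) i~a a~j) (xor-comm (adj G i j) true)

Loopless : Graph n → Vec Bool n → Set
Loopless G S = ∀ {i} → i ∈ S → adj G i i ≡ false

-- Kernels of induced subgraphs

Kernel : Graph n → Vec Bool n → Vec Bool n → Set
Kernel G S x = x ⊆ S × (∀ {i} → i ∈ S → row G i x ≡ false)

Kernel-reflects : (G : Graph n) (S x : Vec Bool n) → inKernelᵇ G S x ≡ true ⇔ Kernel G S x
Kernel-reflects {n} G S x = mk⇔ to from
  where
  condition : Fin n → Bool
  condition i = if lookup S i then not (row G i x) else true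
  condition⇔ : ∀ i → Bool.T (condition i) ⇔ (i ∈ S → row G i x ≡ false)
  condition⇔ i with lookup S i
  ... | true = mk⇔ (λ t _ → Equivalence.to T-not-≡ t) (λ r → Equivalence.from T-not-≡ (r refl))
  ... | false = mk⇔ (λ _ ()) _
  to : inKernelᵇ G S x ≡ true → Kernel G S x
  to k with Equivalence.to T-∧ (Equivalence.from T-≡ k)
  ... | x⊆S , conditions =
    Equivalence.to (⊆ᵇ⇔⊆ x S) (Equivalence.to T-≡ x⊆S) ,
    λ {i} → Equivalence.to (condition⇔ i) (tabulate⁻ (all⁺ condition (allFin n) conditions) i)
  from : Kernel G S x → inKernelᵇ G S x ≡ true
  from (x⊆S , rows) = Equivalence.to T-≡ (Equivalence.from T-∧
    ( Equivalence.from T-≡ (Equivalence.from (⊆ᵇ⇔⊆ x S) x⊆S)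
    , all⁻ condition (tabulate⁺ (λ i → Equivalence.from (condition⇔ i) rows))))

kernelIndicator : Graph n → Vec Bool n → Vec Bool n → ℕ
kernelIndicator G S x = if inKernelᵇ G S x then 1 else 0

kernelIndicator-cong : ∀ {m} (G : Graph n) (S x : Vec Bool n) (H : Graph m) (T y : Vec Bool m) →
                       Kernel G S x ⇔ Kernel H T y → kernelIndicator G S x ≡ kernelIndicator H T y
kernelIndicator-cong G S x H T y k⇔k = cong (if_then 1 else 0)
  (⇔→≡ (trans⇔ (Kernel-reflects G S x) (trans⇔ k⇔k (sym⇔ (Kernel-reflects H T y)))))

kernelIndicator-0 : (G : Graph n) (S x : Vec Bool n) → ¬ Kernel G S x → kernelIndicator G S x ≡ 0
kernelIndicator-0 G S x ¬k with inKernelᵇ G S x in k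
... | true = contradiction (Equivalence.to (Kernel-reflects G S x) k) ¬k
... | false = refl

kernelIndicator-1 : (G : Graph n) (S x : Vec Bool n) → Kernel G S x → kernelIndicator G S x ≡ 1
kernelIndicator-1 G S x k = cong (if_then 1 else 0) (Equivalence.from (Kernel-reflects G S x) k)

kernelIndicator-outside : (G : Graph n) (S x : Vec Bool n) → ∀ {a} → a ∉ S → a ∈ x →
                          kernelIndicator G S x ≡ 0
kernelIndicator-outside G S x a∉S a∈x =
  kernelIndicator-0 G S x (λ (x⊆S , _) → ∈∉⇒⊥ S (x⊆S a∈x) a∉S)

select-sum : ∀ c {k} (u : Bool → ℕ) → u c ≡ k → u (not c) ≡ 0 → u false ℕ.+ u true ≡ k
select-sum false u refl u₁≡0 = trans (cong (u false ℕ.+_) u₁≡0) (NP.+-identityʳ _)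
select-sum true u refl u₀≡0 = cong (ℕ._+ u true) u₀≡0

kernelIndicator-select : ∀ {m} (G : Graph n) (S : Vec Bool n) (y : Bool → Vec Bool n)
  (H : Graph m) (T x : Vec Bool m) c → (∀ s → Kernel G S (y s) ⇔ (Kernel H T x × c ≡ s)) →
  kernelIndicator G S (y false) ℕ.+ kernelIndicator G S (y true) ≡ kernelIndicator H T x
kernelIndicator-select G S y H T x c char = select-sum c (kernelIndicator G S ∘ y)
  (kernelIndicator-cong G S (y c) H T x
    (mk⇔ (proj₁ ∘ Equivalence.to (char c)) (λ k → Equivalence.from (char c) (k , refl))))
  (kernelIndicator-0 G S (y (not c)) (not-¬ refl ∘ proj₂ ∘ Equivalence.to (char (not c))))

kernelIndicator-select₂ : ∀ {m} (G : Graph n) (S : Vec Bool n) (y : Bool → Bool → Vec Bool n)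
  (H : Graph m) (T x : Vec Bool m) c d → (∀ s t → Kernel G S (y s t) ⇔ (Kernel H T x × c ≡ s × d ≡ t)) →
  (kernelIndicator G S (y false false) ℕ.+ kernelIndicator G S (y true false)) ℕ.+
  (kernelIndicator G S (y false true) ℕ.+ kernelIndicator G S (y true true)) ≡ kernelIndicator H T x
kernelIndicator-select₂ G S y H T x c d char = select-sum d v v-selected v-other
  where
  κ = kernelIndicator G S
  v : Bool → ℕ
  v t = κ (y false t) ℕ.+ κ (y true t)
  v-selected : v d ≡ kernelIndicator H T x
  v-selected = kernelIndicator-select G S (λ s → y s d) H T x c λ s → mk⇔
    (λ k → let (kH , c≡s , _) = Equivalence.to (char s d) k in kH , c≡s)
    (λ (kH , c≡s) → Equivalence.from (char s d) (kH , c≡s , refl))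
  unselected : ∀ s → κ (y s (not d)) ≡ 0
  unselected s = kernelIndicator-0 G S (y s (not d))
    (not-¬ refl ∘ proj₂ ∘ proj₂ ∘ Equivalence.to (char s (not d)))
  v-other : v (not d) ≡ 0
  v-other = cong₂ ℕ._+_ (unselected false) (unselected true)

module ℕSum = BoolVecSum NP.+-0-isCommutativeMonoid
module ℤSum = BoolVecSum ZP.+-0-isCommutativeMonoid

kernelSize : Graph n → Vec Bool n → ℕ
kernelSize G S = List.length (kernelOf G S)

kernelSize-∑ : (G : Graph n) (S : Vec Bool n) → kernelSize G S ≡ ℕSum.∑ (kernelIndicator G S)
kernelSize-∑ {n} G S = trans (length-filter (allVecs n)) (ℕSum.∑-allVecs (kernelIndicator G S))
  where
  length-filter : ∀ xs → List.length (List.filter (λ x → inKernelᵇ G S x ≟ᵇ true) xs) ≡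
                         List.foldr ℕ._+_ 0 (List.map (kernelIndicator G S) xs)
  length-filter List.[] = refl
  length-filter (x List.∷ xs) with inKernelᵇ G S x
  ... | true = cong ℕ.suc (length-filter xs)
  ... | false = length-filter xs

Kernel-∅ : (G : Graph n) (S : Vec Bool n) → Kernel G S ∅
Kernel-∅ G S = ∅⊆ S , λ {i} _ → dot-vanishes (adj G i) ∅ (λ {j} j∈∅ → ⊥-elim (∈∉⇒⊥ {i = j} ∅ j∈∅ (∉∅ j)))

kernelSize-positive : (G : Graph n) (S : Vec Bool n) → 1 ℕ.≤ kernelSize G S
kernelSize-positive G S = begin
  1                               ≡⟨ kernelIndicator-1 G S ∅ (Kernel-∅ G S) ⟨
  kernelIndicator G S ∅           ≤⟨ ∑-≥-term (kernelIndicator G S) ∅ ⟩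
  ℕSum.∑ (kernelIndicator G S)    ≡⟨ kernelSize-∑ G S ⟨
  kernelSize G S                  ∎
  where
  open NP.≤-Reasoning
  ∑-≥-term : ∀ {n} (f : Vec Bool n → ℕ) x → f x ℕ.≤ ℕSum.∑ f
  ∑-≥-term f [] = NP.≤-refl
  ∑-≥-term f (false ∷ x) = NP.≤-trans (∑-≥-term (f ∘ (false ∷_)) x) (NP.m≤m+n _ _)
  ∑-≥-term f (true ∷ x) = NP.≤-trans (∑-≥-term (f ∘ (true ∷_)) x) (NP.m≤n+m _ _)

kernelSize-empty : (G : Graph n) (S : Vec Bool n) → Empty S → kernelSize G S ≡ 1
kernelSize-empty G S S-empty = begin
  kernelSize G S               ≡⟨ kernelSize-∑ G S ⟩
  ℕSum.∑ (kernelIndicator G S) ≡⟨ ℕSum.∑-supported-at-∅ (kernelIndicator G S) outside-∅ ⟩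
  kernelIndicator G S ∅        ≡⟨ kernelIndicator-1 G S ∅ (Kernel-∅ G S) ⟩
  1                            ∎
  where
  open ≡-Reasoning
  outside-∅ : ∀ x {i} → i ∈ x → kernelIndicator G S x ≡ 0
  outside-∅ x {i} i∈x = kernelIndicator-0 G S x (λ (x⊆S , _) → ∈∉⇒⊥ S (x⊆S i∈x) (S-empty i))

row-insertIf : (G : Graph n) (i : Fin n) (x : Vec Bool n) → ∀ s {a} → a ∉ x →
               row G i (insertIf s a x) ≡ row G i x xor (s ∧ adj G i a)
row-insertIf G i = dot-insertIf (adj G i)

Kernel-insertIf : (G : Graph n) (S x : Vec Bool n) → ∀ s {a} → a ∉ x →
  Kernel G (insert a S) (insertIf s a x) ⇔
  (x ⊆ S × row G a x xor (s ∧ adj G a a) ≡ false ×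
   (∀ {i} → i ∈ S → row G i x xor (s ∧ adj G i a) ≡ false))
Kernel-insertIf G S x s {a} a∉x = mk⇔
  (λ (y⊆ , rows) →
      insertIf-mono⁻ s a x S a∉x y⊆
    , trans (sym (row-insertIf G a x s a∉x)) (rows (a∈insert a S))
    , λ {i} i∈S → trans (sym (row-insertIf G i x s a∉x)) (rows (⊆-insert a S i∈S)))
  (λ (x⊆S , row-a , rows) →
      insertIf-mono s a x S x⊆S
    , λ {i} i∈ → trans (row-insertIf G i x s a∉x) (case ∈-insert⁻ S i∈ of λ where
        (inj₁ refl) → row-a
        (inj₂ i∈S) → rows i∈S))

-- The equation of row a fixes the a-coordinate to row G a x; eliminating it from the
-- remaining equations produces the rows of the local complement.
Kernel-localComplement : (G : Graph n) (S x : Vec Bool n) → ∀ s {a} → adj G a a ≡ true → a ∉ x →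
  Kernel G (insert a S) (insertIf s a x) ⇔ (Kernel (localComplement G a) S x × row G a x ≡ s)
Kernel-localComplement G S x s {a} a-looped a∉x = trans⇔ (Kernel-insertIf G S x s a∉x) (mk⇔
  (λ (x⊆S , ra , rows) → let r≡s = xor≡false⇒≡ (trans (sym row-a) ra) in
     (x⊆S , λ i∈S → trans (row-i _ r≡s) (rows i∈S)) , r≡s)
  (λ ((x⊆S , rows) , r≡s) →
     x⊆S , trans row-a (≡⇒xor≡false r≡s) , λ i∈S → trans (sym (row-i _ r≡s)) (rows i∈S)))
  where
  row-a : row G a x xor (s ∧ adj G a a) ≡ row G a x xor s
  row-a = cong (row G a x xor_) (trans (cong (s ∧_) a-looped) (∧-identityʳ s))
  row-i : ∀ i → row G a x ≡ s → row (localComplement G a) i x ≡ row G i x xor (s ∧ adj G i a)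
  row-i i refl = row-localComplement G a i x

Kernel-isolated : (G : Graph n) (S x : Vec Bool n) → ∀ s {a} →
  adj G a a ≡ false → (∀ {j} → j ∈ S → adj G a j ≡ false) → a ∉ x →
  Kernel G (insert a S) (insertIf s a x) ⇔ Kernel G S x
Kernel-isolated G S x s {a} a-unlooped a-isolated a∉x = trans⇔ (Kernel-insertIf G S x s a∉x) (mk⇔
  (λ (x⊆S , _ , rows) → x⊆S , λ i∈S → trans (sym (row-i i∈S)) (rows i∈S))
  (λ (x⊆S , rows) → x⊆S , row-a x⊆S , λ i∈S → trans (row-i i∈S) (rows i∈S)))
  where
  no-edge : ∀ {c} → adj G a c ≡ false → row G c x xor (s ∧ adj G c a) ≡ row G c x
  no-edge {c} a≁c = trans (cong (λ e → row G c x xor (s ∧ e)) (trans (symm G c a) a≁c))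
                          (trans (cong (row G c x xor_) (∧-zeroʳ s)) (xor-identityʳ _))
  row-i : ∀ {i} → i ∈ S → row G i x xor (s ∧ adj G i a) ≡ row G i x
  row-i i∈S = no-edge (a-isolated i∈S)
  row-a : x ⊆ S → row G a x xor (s ∧ adj G a a) ≡ false
  row-a x⊆S = trans (no-edge a-unlooped) (dot-vanishes (adj G a) x (a-isolated ∘ x⊆S))

-- As a, b are unlooped and adjacent, the equation of row a fixes the b-coordinate and that
-- of row b fixes the a-coordinate; eliminating both produces the rows of the pivot.
Kernel-pivot : (G : Graph n) (T x : Vec Bool n) → ∀ s t {a b} →
  adj G a a ≡ false → adj G b b ≡ false → adj G a b ≡ true → a ≢ b → a ∉ x → b ∉ x →
  Kernel G (insert a (insert b T)) (insertIf s a (insertIf t b x)) ⇔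
  (Kernel (pivot G a b) T x × row G b x ≡ s × row G a x ≡ t)
Kernel-pivot G T x s t {a} {b} a-unlooped b-unlooped a~b a≢b a∉x b∉x =
  trans⇔ (Kernel-insertIf G (insert b T) (insertIf t b x) s (∉-insertIf t x a≢b a∉x)) (mk⇔
  (λ (x′⊆ , ra , rows) →
     let t≡ = xor≡false⇒≡ (trans (sym (trans (row-y a) cond-a)) ra)
         s≡ = xor≡false⇒≡ (trans (sym (trans (row-y b) cond-b)) (rows (a∈insert b T)))
     in (insertIf-mono⁻ t b x T b∉x x′⊆ ,
         λ i∈T → trans (cond-pivot s≡ t≡ _) (trans (sym (row-y _)) (rows (⊆-insert b T i∈T))))
        , s≡ , t≡)
  (λ ((x⊆T , rows) , s≡ , t≡) →
       insertIf-mono t b x T x⊆T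
     , trans (row-y a) (trans cond-a (≡⇒xor≡false t≡))
     , λ {i} i∈ → trans (row-y i) (case ∈-insert⁻ T i∈ of λ where
         (inj₁ refl) → trans cond-b (≡⇒xor≡false s≡)
         (inj₂ i∈T) → trans (sym (cond-pivot s≡ t≡ i)) (rows i∈T))))
  where
  cond : Fin _ → Bool
  cond i = (row G i x xor (t ∧ adj G i b)) xor (s ∧ adj G i a)
  row-y : ∀ i → row G i (insertIf t b x) xor (s ∧ adj G i a) ≡ cond i
  row-y i = cong (_xor (s ∧ adj G i a)) (row-insertIf G i x t b∉x)
  cond-a : cond a ≡ row G a x xor t
  cond-a rewrite a~b | a-unlooped | ∧-identityʳ t | ∧-zeroʳ s = xor-identityʳ (row G a x xor t)
  cond-b : cond b ≡ row G b x xor s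
  cond-b rewrite b-unlooped | symm G b a | a~b | ∧-zeroʳ t | ∧-identityʳ s =
    cong (_xor s) (xor-identityʳ (row G b x))
  cond-pivot : row G b x ≡ s → row G a x ≡ t → ∀ i → row (pivot G a b) i x ≡ cond i
  cond-pivot refl refl i = row-pivot G a b i x

kernelSize-localComplement : (G : Graph n) (S : Vec Bool n) → ∀ {a} → adj G a a ≡ true → a ∉ S →
  kernelSize G (insert a S) ≡ kernelSize (localComplement G a) S
kernelSize-localComplement G S {a} a-looped a∉S = begin
  kernelSize G (insert a S)                          ≡⟨ kernelSize-∑ G (insert a S) ⟩
  ℕSum.∑ (kernelIndicator G (insert a S))            ≡⟨ ℕSum.∑-pairing a _ _
                                                          (λ x → kernelIndicator-outside H S x a∉S) pairs ⟩
  ℕSum.∑ (kernelIndicator H S)                       ≡⟨ kernelSize-∑ H S ⟨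
  kernelSize H S                                     ∎
  where
  open ≡-Reasoning
  H = localComplement G a
  pairs : ∀ x → a ∉ x → kernelIndicator G (insert a S) x ℕ.+ kernelIndicator G (insert a S) (insert a x) ≡
                        kernelIndicator H S x
  pairs x a∉x = kernelIndicator-select G (insert a S) (λ s → insertIf s a x) H S x (row G a x)
                  (λ s → Kernel-localComplement G S x s a-looped a∉x)

kernelSize-isolated : (G : Graph n) (S : Vec Bool n) → ∀ {a} →
  adj G a a ≡ false → (∀ {j} → j ∈ S → adj G a j ≡ false) → a ∉ S →
  kernelSize G (insert a S) ≡ kernelSize G S ℕ.+ kernelSize G S
kernelSize-isolated G S {a} a-unlooped a-isolated a∉S = begin
  kernelSize G (insert a S)                         ≡⟨ kernelSize-∑ G (insert a S) ⟩
  ℕSum.∑ (kernelIndicator G (insert a S))           ≡⟨ ℕSum.∑-pairing a _ _ vanishes pairs ⟩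
  ℕSum.∑ (λ x → kernelIndicator G S x ℕ.+ kernelIndicator G S x)
                                                    ≡⟨ ℕSum.∑-distrib (kernelIndicator G S) (kernelIndicator G S) ⟩
  ℕSum.∑ (kernelIndicator G S) ℕ.+ ℕSum.∑ (kernelIndicator G S)
                                                    ≡⟨ cong₂ ℕ._+_ (kernelSize-∑ G S) (kernelSize-∑ G S) ⟨
  kernelSize G S ℕ.+ kernelSize G S                 ∎
  where
  open ≡-Reasoning
  vanishes : ∀ x → a ∈ x → kernelIndicator G S x ℕ.+ kernelIndicator G S x ≡ 0
  vanishes x a∈x rewrite kernelIndicator-outside G S x a∉S a∈x = refl
  same : ∀ x s → a ∉ x → kernelIndicator G (insert a S) (insertIf s a x) ≡ kernelIndicator G S x
  same x s a∉x = kernelIndicator-cong G (insert a S) (insertIf s a x) G S x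
                   (Kernel-isolated G S x s a-unlooped a-isolated a∉x)
  pairs : ∀ x → a ∉ x → kernelIndicator G (insert a S) x ℕ.+ kernelIndicator G (insert a S) (insert a x) ≡
                        kernelIndicator G S x ℕ.+ kernelIndicator G S x
  pairs x a∉x = cong₂ ℕ._+_ (same x false a∉x) (same x true a∉x)

kernelSize-pivot : (G : Graph n) (T : Vec Bool n) → ∀ {a b} →
  adj G a a ≡ false → adj G b b ≡ false → adj G a b ≡ true → a ≢ b → a ∉ T → b ∉ T →
  kernelSize G (insert a (insert b T)) ≡ kernelSize (pivot G a b) T
kernelSize-pivot G T {a} {b} a-unlooped b-unlooped a~b a≢b a∉T b∉T = begin
  kernelSize G S  ≡⟨ kernelSize-∑ G S ⟩
  ℕSum.∑ f        ≡⟨ ℕSum.∑-pair a f ⟩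
  ℕSum.∑ h        ≡⟨ ℕSum.∑-pairing b h g (λ x → kernelIndicator-outside H T x b∉T) pairs ⟩
  ℕSum.∑ g        ≡⟨ kernelSize-∑ H T ⟨
  kernelSize H T  ∎
  where
  open ≡-Reasoning
  S = insert a (insert b T)
  H = pivot G a b
  f g h : Vec Bool _ → ℕ
  f = kernelIndicator G S
  g = kernelIndicator H T
  h x = if lookup x a then 0 else f x ℕ.+ f (insert a x)
  quadruple : ∀ x → a ∉ x → b ∉ x →
    (f x ℕ.+ f (insert a x)) ℕ.+ (f (insert b x) ℕ.+ f (insert a (insert b x))) ≡ g x
  quadruple x a∉x b∉x =
    kernelIndicator-select₂ G S (λ s t → insertIf s a (insertIf t b x)) H T x (row G b x) (row G a x)
      (λ s t → Kernel-pivot G T x s t a-unlooped b-unlooped a~b a≢b a∉x b∉x)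
  pairs : ∀ x → b ∉ x → h x ℕ.+ h (insert b x) ≡ g x
  pairs x b∉x rewrite lookup∘update′ a≢b x true with lookup x a in x[a]
  ... | true = sym (kernelIndicator-outside H T x a∉T x[a])
  ... | false = quadruple x x[a] b∉x

-- Parity of the nullity

sign : Graph n → Vec Bool n → ℤ.ℤ
sign G S = negOnePow (nullity G S)

sign-localComplement : (G : Graph n) (S : Vec Bool n) → ∀ {a} → adj G a a ≡ true → a ∉ S →
                       sign G (insert a S) ≡ sign (localComplement G a) S
sign-localComplement G S a-looped a∉S =
  cong (negOnePow ∘ ⌊log₂_⌋) (kernelSize-localComplement G S a-looped a∉S)

sign-pivot : (G : Graph n) (T : Vec Bool n) → ∀ {a b} →
  adj G a a ≡ false → adj G b b ≡ false → adj G a b ≡ true → a ≢ b → a ∉ T → b ∉ T →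
  sign G (insert a (insert b T)) ≡ sign (pivot G a b) T
sign-pivot G T a-unlooped b-unlooped a~b a≢b a∉T b∉T =
  cong (negOnePow ∘ ⌊log₂_⌋) (kernelSize-pivot G T a-unlooped b-unlooped a~b a≢b a∉T b∉T)

sign-isolated : (G : Graph n) (S : Vec Bool n) → ∀ {a} →
  adj G a a ≡ false → (∀ {j} → j ∈ S → adj G a j ≡ false) → a ∉ S →
  sign G (insert a S) ≡ ℤ.- sign G S
sign-isolated G S {a} a-unlooped a-isolated a∉S = cong negOnePow (begin
  ⌊log₂ kernelSize G (insert a S) ⌋ ≡⟨ cong ⌊log₂_⌋ (kernelSize-isolated G S a-unlooped a-isolated a∉S) ⟩
  ⌊log₂ (k ℕ.+ k) ⌋                 ≡⟨ cong (λ m → ⌊log₂ (k ℕ.+ m) ⌋) (NP.+-identityʳ k) ⟨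
  ⌊log₂ (2 ℕ.* k) ⌋                 ≡⟨ ⌊log₂[2*b]⌋≡1+⌊log₂b⌋ k {{ℕ.>-nonZero (kernelSize-positive G S)}} ⟩
  ℕ.suc ⌊log₂ k ⌋                   ∎)
  where
  open ≡-Reasoning
  k = kernelSize G S

sign-empty : (G : Graph n) (S : Vec Bool n) → Empty S → sign G S ≡ + 1
sign-empty G S S-empty = cong (negOnePow ∘ ⌊log₂_⌋) (kernelSize-empty G S S-empty)

sign-loopless : ∀ k (G : Graph n) (S : Vec Bool n) → size S ℕ.< k → Loopless G S →
                sign G S ≡ negOnePow (size S)
sign-loopless ℕ.zero G S () loopless
sign-loopless (ℕ.suc k) G S size<k loopless with nonempty-or-empty S
... | inj₂ S-empty = trans (sign-empty G S S-empty) (cong negOnePow (sym (size-empty S S-empty)))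
... | inj₁ (a , a∈S) = begin
  sign G S                    ≡⟨ cong (sign G) (insert-remove S a∈S) ⟨
  sign G (insert a T)         ≡⟨ by-neighbour neighbour? ⟩
  negOnePow (ℕ.suc (size T))  ≡⟨ cong negOnePow (size-remove a S a∈S) ⟨
  negOnePow (size S)          ∎
  where
  open ≡-Reasoning
  T = remove a S
  a∉T : a ∉ T
  a∉T = a∉remove a S
  T<k : size T ℕ.< k
  T<k = remove-shrinks S a∈S size<k
  neighbour? : Dec (∃ λ b → b ∈ T × adj G a b ≡ true)
  neighbour? = any? (λ b → (lookup T b ≟ᵇ true) ×-dec (adj G a b ≟ᵇ true))
  by-neighbour : Dec (∃ λ b → b ∈ T × adj G a b ≡ true) → sign G (insert a T) ≡ negOnePow (ℕ.suc (size T))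
  by-neighbour (no no-neighbour) = begin
    sign G (insert a T)         ≡⟨ sign-isolated G T (loopless a∈S) a-isolated a∉T ⟩
    ℤ.- sign G T                ≡⟨ cong ℤ.-_ (sign-loopless k G T T<k (loopless ∘ ∈-remove⁻ S)) ⟩
    negOnePow (ℕ.suc (size T))  ∎
    where
    a-isolated : ∀ {j} → j ∈ T → adj G a j ≡ false
    a-isolated {j} j∈T = ¬-not (λ a~j → no-neighbour (j , j∈T , a~j))
  by-neighbour (yes (b , b∈T , a~b)) = begin
    sign G (insert a T)                     ≡⟨ cong (sign G ∘ insert a) (insert-remove T b∈T) ⟨
    sign G (insert a (insert b T′))         ≡⟨ sign-pivot G T′ (loopless a∈S) (loopless (∈-remove⁻ S b∈T))
                                                 a~b (≢-sym (∈⇒≢ T a∉T b∈T)) (∉-remove b T a∉T) (a∉remove b T) ⟩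
    sign (pivot G a b) T′                   ≡⟨ sign-loopless k (pivot G a b) T′ T′<k pivot-loopless ⟩
    negOnePow (size T′)                     ≡⟨ ZP.neg-involutive (negOnePow (size T′)) ⟨
    negOnePow (ℕ.suc (ℕ.suc (size T′)))     ≡⟨ cong (negOnePow ∘ ℕ.suc) (size-remove b T b∈T) ⟨
    negOnePow (ℕ.suc (size T))              ∎
    where
    T′ = remove b T
    T′<k : size T′ ℕ.< k
    T′<k = NP.<-trans (NP.n<1+n _) (subst (ℕ._< k) (size-remove b T b∈T) T<k)
    pivot-loopless : Loopless (pivot G a b) T′
    pivot-loopless {i} i∈T′ = trans (pivot-loop G a b i) (loopless (∈-remove⁻ S (∈-remove⁻ T i∈T′)))

-- ε of induced subgraphs

εOn : Graph n → Vec Bool n → ℤ.ℤ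
εOn G W = ℤSum.∑ (λ S → if S ⊆ᵇ W then sign G S else + 0)

ε≡εOn-full : (G : Graph n) → ε G ≡ εOn G full
ε≡εOn-full {n} G = trans (ℤSum.∑-allVecs (sign G)) (ℤSum.∑-cong λ S →
  cong (if_then sign G S else + 0)
       (sym (Equivalence.from (⊆ᵇ⇔⊆ S full) (λ {i} _ → ∈full i))))

εOn-empty : (G : Graph n) (W : Vec Bool n) → Empty W → εOn G W ≡ + 1
εOn-empty G W W-empty = begin
  εOn G W                               ≡⟨ ℤSum.∑-supported-at-∅ _ outside-∅ ⟩
  (if ∅ ⊆ᵇ W then sign G ∅ else + 0)    ≡⟨ cong (if_then sign G ∅ else + 0) ∅⊆ᵇW ⟩
  sign G ∅                              ≡⟨ sign-empty G ∅ ∉∅ ⟩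
  + 1                                   ∎
  where
  open ≡-Reasoning
  ∅⊆ᵇW : ∅ ⊆ᵇ W ≡ true
  ∅⊆ᵇW = Equivalence.from (⊆ᵇ⇔⊆ ∅ W) (∅⊆ W)
  outside-∅ : ∀ S {i} → i ∈ S → (if S ⊆ᵇ W then sign G S else + 0) ≡ + 0
  outside-∅ S {i} i∈S = cong (if_then sign G S else + 0)
    (⊆ᵇ-false S W (λ S⊆W → ∈∉⇒⊥ W (S⊆W i∈S) (W-empty i)))

εOn-loopless : (G : Graph n) (W : Vec Bool n) → ∀ {a} → a ∈ W → Loopless G W → εOn G W ≡ + 0
εOn-loopless {n} G W {a} a∈W loopless =
  trans (ℤSum.∑-pairing a f (λ _ → + 0) (λ _ _ → refl) pairs) (ℤSum.∑-0# n)
  where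
  f : Vec Bool n → ℤ.ℤ
  f S = if S ⊆ᵇ W then sign G S else + 0
  pairs : ∀ S → a ∉ S → f S ℤ.+ f (insert a S) ≡ + 0
  pairs S a∉S rewrite insert-⊆ᵇ-remove S W a∈W a∉S | sym (⊆ᵇ-remove S W a∉S) with S ⊆ᵇ W in S⊆ᵇW
  ... | false = refl
  ... | true = begin
    sign G S ℤ.+ sign G (insert a S)
      ≡⟨ cong₂ ℤ._+_ (sign-loopless _ G S NP.≤-refl (loopless ∘ S⊆W))
                     (sign-loopless _ G (insert a S) NP.≤-refl (loopless ∘ insert-⊆ S W a∈W S⊆W)) ⟩
    negOnePow (size S) ℤ.+ negOnePow (size (insert a S))
      ≡⟨ cong (λ m → negOnePow (size S) ℤ.+ negOnePow m) (size-insert a S a∉S) ⟩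
    negOnePow (size S) ℤ.+ ℤ.- negOnePow (size S)
      ≡⟨ ZP.+-inverseʳ (negOnePow (size S)) ⟩
    + 0 ∎
    where
    open ≡-Reasoning
    S⊆W : S ⊆ W
    S⊆W = Equivalence.to (⊆ᵇ⇔⊆ S W) S⊆ᵇW

εOn-looped : (G : Graph n) (W : Vec Bool n) → ∀ {a} → adj G a a ≡ true → a ∈ W →
             εOn G W ≡ εOn G (remove a W) ℤ.+ εOn (localComplement G a) (remove a W)
εOn-looped {n} G W {a} a-looped a∈W = begin
  εOn G W                                ≡⟨ ℤSum.∑-pairing a f (λ S → g G S ℤ.+ g H S) vanishes pairs ⟩
  ℤSum.∑ (λ S → g G S ℤ.+ g H S)         ≡⟨ ℤSum.∑-distrib (g G) (g H) ⟩
  εOn G W′ ℤ.+ εOn H W′                  ∎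
  where
  open ≡-Reasoning
  W′ = remove a W
  H = localComplement G a
  f : Vec Bool n → ℤ.ℤ
  f S = if S ⊆ᵇ W then sign G S else + 0
  g : Graph n → Vec Bool n → ℤ.ℤ
  g K S = if S ⊆ᵇ W′ then sign K S else + 0
  vanishes : ∀ S → a ∈ S → g G S ℤ.+ g H S ≡ + 0
  vanishes S a∈S rewrite ⊆ᵇ-false S W′ (λ S⊆W′ → ∈∉⇒⊥ W′ (S⊆W′ a∈S) (a∉remove a W)) = refl
  pairs : ∀ S → a ∉ S → f S ℤ.+ f (insert a S) ≡ g G S ℤ.+ g H S
  pairs S a∉S rewrite ⊆ᵇ-remove S W a∉S | insert-⊆ᵇ-remove S W a∈W a∉S
                    | sign-localComplement G S a-looped a∉S with S ⊆ᵇ W′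
  ... | true = refl
  ... | false = refl

εOn-nonnegative : ∀ k (G : Graph n) (W : Vec Bool n) → size W ℕ.< k → + 0 ℤ.≤ εOn G W
εOn-nonnegative ℕ.zero G W ()
εOn-nonnegative (ℕ.suc k) G W size<k with any? (λ a → (lookup W a ≟ᵇ true) ×-dec (adj G a a ≟ᵇ true))
... | yes (a , a∈W , a-looped) = subst (+ 0 ℤ.≤_) (sym (εOn-looped G W a-looped a∈W))
  (ZP.+-mono-≤ (εOn-nonnegative k G W′ W′<k) (εOn-nonnegative k (localComplement G a) W′ W′<k))
  where
  W′ = remove a W
  W′<k = remove-shrinks W a∈W size<k
... | no no-loop with nonempty-or-empty W
...   | inj₁ (a , a∈W) = ZP.≤-reflexive (sym (εOn-loopless G W a∈W loopless))
  where
  loopless : Loopless G W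
  loopless {i} i∈W = ¬-not (λ i-looped → no-loop (i , i∈W , i-looped))
...   | inj₂ W-empty = subst (+ 0 ℤ.≤_) (sym (εOn-empty G W W-empty)) (ℤ.+≤+ ℕ.z≤n)

-- Loops reachable inside an induced subgraph

data Walk (G : Graph n) (W : Vec Bool n) : Fin n → Fin n → Set where
  here : ∀ {u} → u ∈ W → Walk G W u u
  step : ∀ {u v w} → u ∈ W → adj G u v ≡ true → Walk G W v w → Walk G W u w

Walk-head : ∀ {G : Graph n} {W u v} → Walk G W u v → u ∈ W
Walk-head (here u∈W) = u∈W
Walk-head (step u∈W _ _) = u∈W

Walk-last : ∀ {G : Graph n} {W u v} → Walk G W u v → v ∈ W
Walk-last (here v∈W) = v∈W
Walk-last (step _ _ p) = Walk-last p

Walk-++ : ∀ {G : Graph n} {W u v w} → Walk G W u v → Walk G W v w → Walk G W u w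
Walk-++ (here _) q = q
Walk-++ (step u∈W u~v p) q = step u∈W u~v (Walk-++ p q)

Reach⇒Walk-full : ∀ {G : Graph n} {u v} → Reach G u v → Walk G full u v
Reach⇒Walk-full {u = u} here = here (∈full u)
Reach⇒Walk-full {u = u} (step u~v p) = step (∈full u) u~v (Reach⇒Walk-full p)

LoopReachable : Graph n → Vec Bool n → Fin n → Set
LoopReachable {n} G W u = ∃ λ (l : Fin n) → adj G l l ≡ true × Walk G W u l

-- Only the double negation is required, so that `split` needs excluded middle for a single
-- proposition; this suffices because the conclusion of εOn-≥2 is decidable.
LoopsReachable : Graph n → Vec Bool n → Set
LoopsReachable G W = ∀ {u} → u ∈ W → ¬ ¬ LoopReachable G W u

module LoopSplit (G : Graph n) (W : Vec Bool n) {a : Fin n} (a-looped : adj G a a ≡ true) where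

  W′ : Vec Bool n
  W′ = remove a W

  H : Graph n
  H = localComplement G a

  loop-or-neighbour : ∀ {u l} → u ∈ W′ → adj G l l ≡ true → Walk G W u l →
                      LoopReachable G W′ u ⊎ ∃ λ c → adj G c a ≡ true × Walk G W′ u c
  loop-or-neighbour {u} u∈W′ l-looped (here _) = inj₁ (u , l-looped , here u∈W′)
  loop-or-neighbour {u} u∈W′ l-looped (step {v = v} _ u~v p) with v ≟ a
  ... | yes refl = inj₂ (u , u~v , here u∈W′)
  ... | no v≢a with loop-or-neighbour (∈-remove⁺ W v≢a (Walk-head p)) l-looped p
  ...   | inj₁ (l′ , l′-looped , q) = inj₁ (l′ , l′-looped , step u∈W′ u~v q)
  ...   | inj₂ (c , c~a , q) = inj₂ (c , c~a , step u∈W′ u~v q)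

  -- A neighbour c₀ of a that reaches no loop in G[W′] is unlooped, so it is looped in H;
  -- every other neighbour of a becomes looped in H or adjacent to c₀ in H.
  module _ {c₀} (c₀∈W′ : c₀ ∈ W′) (c₀~a : adj G c₀ a ≡ true)
           (c₀-stuck : ¬ LoopReachable G W′ c₀) where

    c₀-unlooped : adj G c₀ c₀ ≡ false
    c₀-unlooped = ¬-not (λ c₀-looped → c₀-stuck (c₀ , c₀-looped , here c₀∈W′))

    ~a⇒a~ : ∀ {v} → adj G v a ≡ true → adj G a v ≡ true
    ~a⇒a~ {v} v~a = trans (symm G a v) v~a

    c₀-looped-in-H : adj H c₀ c₀ ≡ true
    c₀-looped-in-H = trans (localComplement-toggles G a c₀ c₀ c₀~a (~a⇒a~ c₀~a)) (cong not c₀-unlooped)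

    neighbour-reaches : ∀ {v} → v ∈ W′ → adj G v a ≡ true → LoopReachable H W′ v
    neighbour-reaches {v} v∈W′ v~a with adj G v v in v-loop
    ... | false = v , trans (localComplement-toggles G a v v v~a (~a⇒a~ v~a)) (cong not v-loop) , here v∈W′
    ... | true = c₀ , c₀-looped-in-H , step v∈W′ v~c₀-in-H (here c₀∈W′)
      where
      v≁c₀ : adj G v c₀ ≡ false
      v≁c₀ = ¬-not λ v~c₀ →
        c₀-stuck (v , v-loop , step c₀∈W′ (trans (symm G c₀ v) v~c₀) (here v∈W′))
      v~c₀-in-H : adj H v c₀ ≡ true
      v~c₀-in-H = trans (localComplement-toggles G a v c₀ v~a (~a⇒a~ c₀~a)) (cong not v≁c₀)

    reaches-in-H : ∀ {u t} → Walk G W′ u t → adj G t a ≡ true ⊎ adj G t t ≡ true → LoopReachable H W′ u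
    reaches-in-H {u} p t-good with adj G u a in u-a
    ... | true = neighbour-reaches (Walk-head p) u-a
    reaches-in-H {u} (here u∈W′) (inj₁ u~a) | false with () ← trans (sym u-a) u~a
    reaches-in-H {u} (here u∈W′) (inj₂ u-looped) | false =
      u , trans (localComplement-away G a u u u-a) u-looped , here u∈W′
    reaches-in-H {u} (step u∈W′ u~v p) t-good | false with reaches-in-H p t-good
    ... | l , l-looped , q = l , l-looped , step u∈W′ (trans (localComplement-away G a u _ u-a) u~v) q

  split : LoopsReachable G W → ¬ ¬ (LoopsReachable G W′ ⊎ LoopsReachable H W′)
  split reachable = ¬¬-map by-stuck-neighbour ¬¬-excluded-middle
    where
    StuckNeighbour : Set
    StuckNeighbour = ∃ λ c → c ∈ W′ × adj G c a ≡ true × ¬ LoopReachable G W′ c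
    by-stuck-neighbour : Dec StuckNeighbour → LoopsReachable G W′ ⊎ LoopsReachable H W′
    by-stuck-neighbour (yes (c₀ , c₀∈W′ , c₀~a , c₀-stuck)) = inj₂ λ {u} u∈W′ ¬reach →
      reachable (∈-remove⁻ W u∈W′) λ (l , l-looped , p) →
        ¬reach (case loop-or-neighbour u∈W′ l-looped p of λ where
          (inj₁ (l′ , l′-looped , q)) → reaches-in-H c₀∈W′ c₀~a c₀-stuck q (inj₂ l′-looped)
          (inj₂ (c , c~a , q)) → reaches-in-H c₀∈W′ c₀~a c₀-stuck q (inj₁ c~a))
    by-stuck-neighbour (no no-stuck) = inj₁ λ {u} u∈W′ ¬reach →
      reachable (∈-remove⁻ W u∈W′) λ (l , l-looped , p) →
        case loop-or-neighbour u∈W′ l-looped p of λ where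
          (inj₁ reach) → ¬reach reach
          (inj₂ (c , c~a , q)) → no-stuck (c , Walk-last q , c~a ,
            λ (l′ , l′-looped , q′) → ¬reach (l′ , l′-looped , Walk-++ q q′))

εOn-≥2 : ∀ k (G : Graph n) (W : Vec Bool n) → size W ℕ.< k → LoopsReachable G W →
         ∀ {u} → u ∈ W → + 2 ℤ.≤ εOn G W
εOn-≥2 ℕ.zero G W () reachable u∈W
εOn-≥2 (ℕ.suc k) G W size<k reachable u∈W = decidable-stable (+ 2 ZP.≤? εOn G W) λ ¬≥2 →
  reachable u∈W λ (a , a-looped , p) → by-loop a-looped (Walk-last p) ¬≥2
  where
  by-loop : ∀ {a} → adj G a a ≡ true → a ∈ W → ¬ ¬ (+ 2 ℤ.≤ εOn G W)
  by-loop {a} a-looped a∈W ¬≥2 = by-rest (nonempty-or-empty W′)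
    where
    open LoopSplit G W a-looped
    εOn-split : εOn G W ≡ εOn G W′ ℤ.+ εOn H W′
    εOn-split = εOn-looped G W a-looped a∈W
    W′<k : size W′ ℕ.< k
    W′<k = remove-shrinks W a∈W size<k
    by-rest : (∃ λ v → v ∈ W′) ⊎ Empty W′ → ⊥
    by-rest (inj₂ W′-empty) = ¬≥2 (ZP.≤-reflexive (sym (trans εOn-split
      (cong₂ ℤ._+_ (εOn-empty G W′ W′-empty) (εOn-empty H W′ W′-empty)))))
    by-rest (inj₁ (v , v∈W′)) = split reachable λ where
      (inj₁ reachable-G) → ¬≥2 (subst (+ 2 ℤ.≤_) (sym εOn-split)
        (ZP.+-mono-≤ (εOn-≥2 k G W′ W′<k reachable-G v∈W′) (εOn-nonnegative k H W′ W′<k)))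
      (inj₂ reachable-H) → ¬≥2 (subst (+ 2 ℤ.≤_) (sym εOn-split)
        (ZP.+-mono-≤ (εOn-nonnegative k G W′ W′<k) (εOn-≥2 k H W′ W′<k reachable-H v∈W′)))

proposition4 : ∀ {n : ℕ} (G : Graph n) → Connected G → HasLoop G → + 1 < ε G
proposition4 {n} G connected (l , l-looped) = begin-strict
  + 1           <⟨ ℤ.+<+ (NP.n<1+n 1) ⟩
  + 2           ≤⟨ εOn-≥2 (ℕ.suc n) G full (ℕ.s≤s (size≤length full)) reachable (∈full l) ⟩
  εOn G full    ≡⟨ ε≡εOn-full G ⟨
  ε G           ∎
  where
  open ZP.≤-Reasoning
  reachable : LoopsReachable G full
  reachable {u} _ ¬reach = ¬reach (l , l-looped , Reach⇒Walk-full (connected u l))
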